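{- Let $P$ be a finite poset, $\mathbb{K}$ a field of characteristic zero, $C\in\mathbb{K}$ a generic constant, and $v\in P$. Let $(x_1,\dots,x_k)$ be a linear extension of the subposet $\{x\in P: x<v\}$, put $\eta_v=T_{x_1}T_{x_2}\cdots T_{x_k}$ and $\tau_v^*=\eta_vT_v\eta_v^{ -1}$. Then $\Theta\circ\Delta^{ -1}\circ\tau_v=\tau_v^*\circ\Theta\circ\Delta^{ -1}$ on the domains where these maps are defined.
   Context: $\mathbb{K}^P$ is the set of labelings $f:P\to\mathbb{K}$; all maps are birational maps $\mathbb{K}^P\dashrightarrow\mathbb{K}^P$ and products denote composition, rightmost first. A linear extension of a poset $Q$ is a listing of its elements such that $x_i<x_j$ implies $i<j$. $\widehat P$ is $P$ with a new minimum $\widehat0$ and maximum $\widehat1$; $x\lessdot y$ means $y$ covers $x$ in $\widehat P$. Birational order toggle: $T_v$ changes only the label at $v$: $(T_vf)(v)=\dfrac{\sum_{y\in\widehat P,\,y\lessdot v}f(y)}{f(v)\sum_{y\in\widehat P,\,y\gtrdot v}1/f(y)}$, with $f(\widehat0)=1$, $f(\widehat1)=C$; each $T_v$ is an involution. Birational antichain toggle: $\tau_v$ changes only the label at $v$: $(\tau_vg)(v)=C/\sum g(y_1)\cdots g(y_k)$, the sum over all maximal chains $(y_1,\dots,y_k)$ of $P$ containing $v$. $(\Theta f)(x)=C/f(x)$; $(\Delta^{ -1}f)(x)=\sum f(y_1)\cdots f(y_k)$ over all chains $x=y_1\lessdot y_2\lessdot\cdots\lessdot y_k\lessdot\widehat1$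 in $\widehat P$. -}

module Defs where

open import Level using (Level; _⊔_; 0ℓ) renaming (suc to lsuc)
open import Data.Nat using (ℕ; zero; suc)
open import Data.Fin using (Fin) renaming (_<_ to _<ᶠ_)
open import Data.Fin.Properties using (any?) renaming (_≟_ to _≟ᶠ_)
open import Data.List using (List; []; _∷_; map; concatMap; filter; foldr; length; lookup; reverse)
open import Data.List.Relation.Unary.Unique.Propositional using (Unique)
open import Data.List.Membership.Propositional using (_∈_)
import Data.List.Membership.DecPropositional as DecMem
open import Data.Product using (Σ; ∃; _×_; _,_; proj₁; proj₂)
open import Data.Product.Relation.Binary.Pointwise.NonDependent using ()
open import Data.Sum using (_⊎_; inj₁; inj₂)
open import Data.Empty using (⊥)
open import Data.Unit.Polymorphic using (⊤; tt)
open import Data.Bool using (if_then_else_)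
open import Function using (_∘_; _⇔_)
open import Relation.Nullary using (¬_; Dec; yes; no; does)
open import Relation.Nullary.Decidable using (_×-dec_; ¬?; _⊎-dec_)
open import Relation.Unary using (Pred; Decidable)
open import Relation.Binary using (Rel; IsDecPartialOrder)
open import Relation.Binary.PropositionalEquality using (_≡_)
open import Algebra.Bundles using (CommutativeRing)

-- The standard library has no (non-Heyting) field bundle, so we
-- define one: a commutative ring with 0 ≠ 1 and a total function _⁻¹
-- that is a two-sided inverse on nonzero elements (its value at 0 is
-- irrelevant: all divisions below are guarded by a nonzero hypothesis).

record Field (c ℓ : Level) : Set (lsuc (c ⊔ ℓ)) where
  field
    commutativeRing : CommutativeRing c ℓ
  open CommutativeRing commutativeRing public
  field
    _⁻¹      : Carrier → Carrier
    ⁻¹-inverseʳ : ∀ x → ¬ (x ≈ 0#) → (x * (x ⁻¹)) ≈ 1#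
    0≉1      : ¬ (0# ≈ 1#)

  ι : ℕ → Carrier
  ι zero    = 0#
  ι (suc n) = 1# + ι n

CharZero : ∀ {c ℓ} → Field c ℓ → Set ℓ
CharZero K = ∀ n → ¬ (ι (suc n) ≈ 0#)
  where open Field K

record FinPoset : Set₁ where
  field
    n    : ℕ
    _≤_  : Rel (Fin n) 0ℓ
    isDecPartialOrder : IsDecPartialOrder _≡_ _≤_
  open IsDecPartialOrder isDecPartialOrder public using (_≤?_)

  _<_ : Rel (Fin n) 0ℓ
  x < y = x ≤ y × ¬ (x ≡ y)

  _<?_ : ∀ x y → Dec (x < y)
  x <? y = (x ≤? y) ×-dec ¬? (x ≟ᶠ y)

  data Hat : Set where
    bot : Hat
    ⟨_⟩ : Fin n → Hat
    top : Hat

  _<̂_ : Rel Hat 0ℓ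
  bot   <̂ bot   = ⊥
  bot   <̂ ⟨ _ ⟩ = ⊤
  bot   <̂ top   = ⊤
  ⟨ _ ⟩ <̂ bot   = ⊥
  ⟨ x ⟩ <̂ ⟨ y ⟩ = x < y
  ⟨ _ ⟩ <̂ top   = ⊤
  top   <̂ _     = ⊥

  _<̂?_ : ∀ x y → Dec (x <̂ y)
  bot   <̂? bot   = no (λ ())
  bot   <̂? ⟨ _ ⟩ = yes tt
  bot   <̂? top   = yes tt
  ⟨ _ ⟩ <̂? bot   = no (λ ())
  ⟨ x ⟩ <̂? ⟨ y ⟩ = x <? y
  ⟨ _ ⟩ <̂? top   = yes tt
  top   <̂? bot   = no (λ ())
  top   <̂? ⟨ _ ⟩ = no (λ ())
  top   <̂? top   = no (λ ())

  hat-any? : {Q : Hat → Set} → (∀ z → Dec (Q z)) → Dec (∃ Q)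
  hat-any? {Q} Q? with Q? bot | Q? top | any? (Q? ∘ ⟨_⟩)
  ... | yes q | _ | _ = yes (bot , q)
  ... | no _ | yes q | _ = yes (top , q)
  ... | no _ | no _ | yes (i , q) = yes (⟨ i ⟩ , q)
  ... | no ¬b | no ¬t | no ¬i = no λ { (bot , q) → ¬b q ; (top , q) → ¬t q ; (⟨ i ⟩ , q) → ¬i (i , q) }

  _⋖_ : Rel Hat 0ℓ
  x ⋖ y = x <̂ y × ¬ (∃ λ z → x <̂ z × z <̂ y)

  _⋖?_ : ∀ x y → Dec (x ⋖ y)
  x ⋖? y = (x <̂? y) ×-dec ¬? (hat-any? (λ z → (x <̂? z) ×-dec (z <̂? y)))

  hatElems : List Hat
  hatElems = bot ∷ top ∷ map ⟨_⟩ (Data.List.allFin n)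
    where import Data.List

  -- chainsFrom k x : all lists (y₁,…,yₘ) of elements of P with
  -- x ⋖ y₁ ⋖ ⋯ ⋖ yₘ ⋖ 1̂ in P̂, using at most k cover steps
  -- (k = suc n steps always suffice, since a chain in P has ≤ n elements).
  chainsFrom : ℕ → Hat → List (List (Fin n))
  chainsFrom zero    x = []
  chainsFrom (suc k) x = concatMap step (filter (x ⋖?_) hatElems)
    where
    step : Hat → List (List (Fin n))
    step bot     = []
    step ⟨ y ⟩   = map (y ∷_) (chainsFrom k ⟨ y ⟩)
    step top     = [] ∷ []

  -- the maximal chains of P (= saturated chains 0̂ ⋖ y₁ ⋖ ⋯ ⋖ yₘ ⋖ 1̂ of P̂)
  maximalChains : List (List (Fin n))
  maximalChains = chainsFrom (suc n) bot

  record IsLinearExtension (Q : Fin n → Set) (ys : List (Fin n)) : Set where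
    field
      distinct : Unique ys
      elements : ∀ x → (x ∈ ys) ⇔ Q x
      monotone : ∀ i j → lookup ys i < lookup ys j → i <ᶠ j

-- Rational
-- (birational) maps are modelled as maps into Partial, where the
-- condition says that every denominator met in the evaluation is nonzero.

record Partial {a} ℓ (A : Set a) : Set (a ⊔ lsuc ℓ) where
  constructor partial
  field
    Def : Set ℓ
    val : Def → A
open Partial public

pure : ∀ {a ℓ} {A : Set a} → A → Partial ℓ A
pure x = partial ⊤ (λ _ → x)

_>>=_ : ∀ {a b ℓ} {A : Set a} {B : Set b} → Partial ℓ A → (A → Partial ℓ B) → Partial ℓ B
p >>= f = partial (Σ (Def p) λ d → Def (f (val p d))) (λ { (d , e) → val (f (val p d)) e })

_∘ₚ_ : ∀ {a b c ℓ} {A : Set a} {B : Set b} {C : Set c} →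
       (B → Partial ℓ C) → (A → Partial ℓ B) → A → Partial ℓ C
(g ∘ₚ f) x = f x >>= g

tabulateP : ∀ {a ℓ} {I : Set} {A : Set a} → (I → Partial ℓ A) → Partial ℓ (I → A)
tabulateP p = partial (∀ i → Def (p i)) (λ d i → val (p i) (d i))

module Birational {c ℓ} (K : Field c ℓ) (P : FinPoset) (C : Field.Carrier K) where
  open Field K
  open FinPoset P
  open DecMem (_≟ᶠ_ {n}) using (_∈?_)

  Labeling : Set c
  Labeling = Fin n → Carrier

  BMap : Set (c ⊔ lsuc ℓ)
  BMap = Labeling → Partial ℓ Labeling

  _÷_ : Carrier → Carrier → Partial ℓ Carrier
  x ÷ y = partial (¬ (y ≈ 0#)) (λ _ → x * (y ⁻¹))

  sumP : List (Partial ℓ Carrier) → Partial ℓ Carrier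
  sumP = foldr (λ p q → p >>= λ x → q >>= λ y → pure (x + y)) (pure 0#)

  sum : List Carrier → Carrier
  sum = foldr _+_ 0#

  prod : List Carrier → Carrier
  prod = foldr _*_ 1#

  update : Labeling → Fin n → Carrier → Labeling
  update f v a x = if does (x ≟ᶠ v) then a else f x

  ext : Labeling → Hat → Carrier
  ext f bot   = 1#
  ext f ⟨ x ⟩ = f x
  ext f top   = C

  T : Fin n → BMap
  T v f =
    sumP (map (λ y → (1# ÷ ext f y)) (filter (⟨ v ⟩ ⋖?_) hatElems)) >>= λ s →
    (sum (map (ext f) (filter (_⋖? ⟨ v ⟩) hatElems)) ÷ (f v * s)) >>= λ a →
    pure (update f v a)

  τ : Fin n → BMap
  τ v g =
    (C ÷ sum (map (prod ∘ map g) (filter (v ∈?_) maximalChains))) >>= λ a →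
    pure (update g v a)

  Θ : BMap
  Θ f = tabulateP (λ x → C ÷ f x)

  Δ⁻¹ : BMap
  Δ⁻¹ f = pure (λ x → sum (map (λ ys → prod (map f (x ∷ ys))) (chainsFrom (suc n) ⟨ x ⟩)))

  composeT : List (Fin n) → BMap
  composeT []       = pure
  composeT (x ∷ xs) = T x ∘ₚ composeT xs

  -- η_v = T_{x₁}⋯T_{xₖ} and its inverse T_{xₖ}⋯T_{x₁}
  -- (each T_x is an involution)
  η : List (Fin n) → BMap
  η xs = composeT xs

  η⁻¹ : List (Fin n) → BMap
  η⁻¹ xs = composeT (reverse xs)

  τ* : Fin n → List (Fin n) → BMap
  τ* v xs = η xs ∘ₚ (T v ∘ₚ η⁻¹ xs)

  _≋_ : Labeling → Labeling → Set ℓ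
  f ≋ g = ∀ x → f x ≈ g x

module Submission where

-- Fix g, let f₀ = ΘΔ⁻¹g, g′ = τ_v g, f₁ = ΘΔ⁻¹g′.  All quantities are path sums
-- of the weighted cover matrix of P̂: with A(y) = pathBelow g y (chains 0̂ ⋖ ⋯ ⋖ y)
-- and U(y) = pathAbove g y (chains y ⋖ ⋯ ⋖ 1̂) we get Δ⁻¹g(y) = g(y)U(y),
-- A(y) = g(y)·Σ_{w⋖y} A(w), U(y) = Σ_{y⋖w} Δ⁻¹g(w), and the maximal chains
-- through v weigh A(v)U(v).  The one computation, toggle-value, says: if the
-- labels below u are A and those above u are C/Δ⁻¹h with h(u) = g(u), then T_u
-- turns the label a into the b with a·b = A(u)·C/Δ⁻¹h(u).  So η_v⁻¹ and T_v
-- (toggling bottom-up) turn f₀ into A on {y ≤ v}, and η_v (toggling top-down)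
-- turns A into f₁ there; elsewhere f₀ = f₁ already, as changing g at v leaves
-- path sums from points ≰ v unchanged, and A(v) = f₁(v).

open import Defs
open import Data.Fin using (Fin)
open import Data.List using (List)
open import Relation.Binary.PropositionalEquality using (_≡_)

open import Algebra.Bundles using (CommutativeSemiring)
open import Data.Bool using (true; false; if_then_else_)
open import Data.Empty using (⊥-elim)
open import Data.Fin as Fin using (zero; suc)
open import Data.List using ([]; _∷_; _++_; map; concatMap; filter; allFin; length; lookup)
open import Data.List.Relation.Unary.Any using (here; there)
import Data.List.Properties as List
open import Data.Nat as ℕ using (ℕ; z≤n; s≤s)
import Data.Nat.Properties as ℕ
open import Data.Product using (_×_; _,_; proj₁; proj₂)
open import Data.Unit.Polymorphic using (tt)
open import Function using (_∘_)
open import Relation.Nullary using (¬_; Dec; yes; no; does)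
open import Relation.Unary using (Pred; Decidable)
open import Relation.Binary using (DecidableEquality)
import Relation.Binary.PropositionalEquality as ≡

module FieldFacts {c ℓ} (K : Field c ℓ) where
  open Field K
  open import Relation.Binary.Reasoning.Setoid setoid

  ⁻¹-inverseˡ : ∀ x → ¬ (x ≈ 0#) → x ⁻¹ * x ≈ 1#
  ⁻¹-inverseˡ x x≉0 = trans (*-comm _ _) (⁻¹-inverseʳ x x≉0)

  ⁻¹-unique : ∀ {x y} → x * y ≈ 1# → x ⁻¹ ≈ y
  ⁻¹-unique {x} {y} xy≈1 = begin
      x ⁻¹               ≈⟨ sym (*-identityʳ _) ⟩
      x ⁻¹ * 1#          ≈⟨ *-congˡ (sym xy≈1) ⟩
      x ⁻¹ * (x * y)     ≈⟨ sym (*-assoc _ _ _) ⟩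
      (x ⁻¹ * x) * y     ≈⟨ *-congʳ (⁻¹-inverseˡ x x≉0) ⟩
      1# * y             ≈⟨ *-identityˡ y ⟩
      y                  ∎
    where
    x≉0 : ¬ (x ≈ 0#)
    x≉0 x≈0 = 0≉1 (trans (sym (zeroˡ y)) (trans (*-congʳ (sym x≈0)) xy≈1))

  ⁻¹-cong : ∀ {x y} → ¬ (y ≈ 0#) → x ≈ y → x ⁻¹ ≈ y ⁻¹
  ⁻¹-cong y≉0 x≈y = ⁻¹-unique (trans (*-congʳ x≈y) (⁻¹-inverseʳ _ y≉0))

  quotient-unique : ∀ {p q r} → ¬ (q ≈ 0#) → p ≈ r * q → p * q ⁻¹ ≈ r
  quotient-unique {p} {q} {r} q≉0 p≈rq = begin
      p * q ⁻¹          ≈⟨ *-congʳ p≈rq ⟩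
      (r * q) * q ⁻¹    ≈⟨ *-assoc _ _ _ ⟩
      r * (q * q ⁻¹)    ≈⟨ *-congˡ (⁻¹-inverseʳ q q≉0) ⟩
      r * 1#            ≈⟨ *-identityʳ r ⟩
      r                 ∎

  ⁻¹-quotient : ∀ {a c x} → ¬ (c ≈ 0#) → ¬ (x ≈ 0#) → a ≈ c * x ⁻¹ → a ⁻¹ ≈ x * c ⁻¹
  ⁻¹-quotient {a} {c} {x} c≉0 x≉0 a≈c/x = ⁻¹-unique (begin
      a * (x * c ⁻¹)            ≈⟨ *-congʳ a≈c/x ⟩
      (c * x ⁻¹) * (x * c ⁻¹)   ≈⟨ *-assoc _ _ _ ⟩
      c * (x ⁻¹ * (x * c ⁻¹))   ≈⟨ *-congˡ (sym (*-assoc _ _ _)) ⟩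
      c * ((x ⁻¹ * x) * c ⁻¹)   ≈⟨ *-congˡ (*-congʳ (⁻¹-inverseˡ x x≉0)) ⟩
      c * (1# * c ⁻¹)           ≈⟨ *-congˡ (*-identityˡ _) ⟩
      c * c ⁻¹                  ≈⟨ ⁻¹-inverseʳ c c≉0 ⟩
      1#                        ∎)

module ListSums {c ℓ} (R : CommutativeSemiring c ℓ) where
  open CommutativeSemiring R
  open import Data.List.Membership.Propositional using (_∈_)
  open import Data.List.Relation.Unary.Unique.Propositional using (Unique)
  open import Data.List.Relation.Unary.AllPairs using (_∷_)
  import Data.List.Relation.Unary.All as All
  open import Algebra.Solver.Ring.NaturalCoefficients.Default R

  ∑ : ∀ {a} {A : Set a} → List A → (A → Carrier) → Carrier
  ∑ L h = Data.List.foldr _+_ 0# (map h L)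

  ∑-cong : ∀ {a} {A : Set a} (L : List A) {h h′ : A → Carrier} →
           (∀ y → h y ≈ h′ y) → ∑ L h ≈ ∑ L h′
  ∑-cong []      h≈h′ = refl
  ∑-cong (y ∷ L) h≈h′ = +-cong (h≈h′ y) (∑-cong L h≈h′)

  ∑-zero : ∀ {a} {A : Set a} (L : List A) {h : A → Carrier} → (∀ y → h y ≈ 0#) → ∑ L h ≈ 0#
  ∑-zero []      h≈0 = refl
  ∑-zero (y ∷ L) h≈0 = trans (+-cong (h≈0 y) (∑-zero L h≈0)) (+-identityˡ 0#)

  ∑-+ : ∀ {a} {A : Set a} (L : List A) (h k : A → Carrier) →
        ∑ L (λ y → h y + k y) ≈ ∑ L h + ∑ L k
  ∑-+ []      h k = sym (+-identityˡ 0#)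
  ∑-+ (y ∷ L) h k = trans (+-congˡ (∑-+ L h k))
    (solve 4 (λ a b d e → (a :+ b) :+ (d :+ e) := (a :+ d) :+ (b :+ e)) refl (h y) (k y) (∑ L h) (∑ L k))

  ∑-*ˡ : ∀ {a} {A : Set a} (L : List A) (x : Carrier) (h : A → Carrier) →
         ∑ L (λ y → x * h y) ≈ x * ∑ L h
  ∑-*ˡ []      x h = sym (zeroʳ x)
  ∑-*ˡ (y ∷ L) x h = trans (+-congˡ (∑-*ˡ L x h)) (sym (distribˡ x (h y) (∑ L h)))

  ∑-*ʳ : ∀ {a} {A : Set a} (L : List A) (x : Carrier) (h : A → Carrier) →
         ∑ L (λ y → h y * x) ≈ ∑ L h * x
  ∑-*ʳ L x h = trans (∑-cong L (λ y → *-comm (h y) x)) (trans (∑-*ˡ L x h) (*-comm x _))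

  ∑-swap : ∀ {a b} {A : Set a} {B : Set b} (L : List A) (M : List B) (h : A → B → Carrier) →
           ∑ L (λ x → ∑ M (h x)) ≈ ∑ M (λ y → ∑ L (λ x → h x y))
  ∑-swap []      M h = sym (∑-zero M (λ _ → refl))
  ∑-swap (x ∷ L) M h = trans (+-congˡ (∑-swap L M h)) (sym (∑-+ M (h x) (λ y → ∑ L (λ x → h x y))))

  ∑-++ : ∀ {a} {A : Set a} (L M : List A) (h : A → Carrier) → ∑ (L ++ M) h ≈ ∑ L h + ∑ M h
  ∑-++ []      M h = sym (+-identityˡ _)
  ∑-++ (y ∷ L) M h = trans (+-congˡ (∑-++ L M h)) (sym (+-assoc _ _ _))

  ∑-map : ∀ {a b} {A : Set a} {B : Set b} (f : A → B) (L : List A) (h : B → Carrier) →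
          ∑ (map f L) h ≡ ∑ L (h ∘ f)
  ∑-map f L h = ≡.cong (Data.List.foldr _+_ 0#) (≡.sym (List.map-∘ L))

  ∑-concatMap : ∀ {a b} {A : Set a} {B : Set b} (s : A → List B) (L : List A) (h : B → Carrier) →
                ∑ (concatMap s L) h ≈ ∑ L (λ y → ∑ (s y) h)
  ∑-concatMap s []      h = refl
  ∑-concatMap s (y ∷ L) h = trans (∑-++ (s y) (concatMap s L) h) (+-congˡ (∑-concatMap s L h))

  𝟙[_]_ : ∀ {p} {Q : Set p} → Dec Q → Carrier → Carrier
  𝟙[ d ] a = if does d then a else 0#

  𝟙-cong : ∀ {p} {Q : Set p} (d : Dec Q) {a b} → (Q → a ≈ b) → 𝟙[ d ] a ≈ 𝟙[ d ] b
  𝟙-cong (yes q) a≈b = a≈b q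
  𝟙-cong (no _)  a≈b = refl

  𝟙-yes : ∀ {p} {Q : Set p} (d : Dec Q) {a} → Q → 𝟙[ d ] a ≈ a
  𝟙-yes (yes _) _ = refl
  𝟙-yes (no ¬q) q = ⊥-elim (¬q q)

  𝟙-no : ∀ {p} {Q : Set p} (d : Dec Q) {a} → ¬ Q → 𝟙[ d ] a ≈ 0#
  𝟙-no (yes q) ¬q = ⊥-elim (¬q q)
  𝟙-no (no _)  ¬q = refl

  𝟙-*ʳ : ∀ {p} {Q : Set p} (d : Dec Q) a b → 𝟙[ d ] a * b ≈ 𝟙[ d ] (a * b)
  𝟙-*ʳ (yes _) a b = refl
  𝟙-*ʳ (no _)  a b = zeroˡ b

  𝟙-*ˡ : ∀ {p} {Q : Set p} (d : Dec Q) a b → b * 𝟙[ d ] a ≈ 𝟙[ d ] (b * a)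
  𝟙-*ˡ (yes _) a b = refl
  𝟙-*ˡ (no _)  a b = zeroʳ b

  𝟙-⇔ : ∀ {p q} {Q : Set p} {R : Set q} (d : Dec Q) (e : Dec R) {a} → (Q → R) → (R → Q) → 𝟙[ d ] a ≈ 𝟙[ e ] a
  𝟙-⇔ (yes q) e Q⇒R R⇒Q = sym (𝟙-yes e (Q⇒R q))
  𝟙-⇔ (no ¬q) e Q⇒R R⇒Q = sym (𝟙-no e (¬q ∘ R⇒Q))

  ∑-vanish : ∀ {a} {A : Set a} (L : List A) {h : A → Carrier} → (∀ {y} → y ∈ L → h y ≈ 0#) → ∑ L h ≈ 0#
  ∑-vanish []      h≈0 = refl
  ∑-vanish (y ∷ L) h≈0 = trans (+-cong (h≈0 (here ≡.refl)) (∑-vanish L (h≈0 ∘ there))) (+-identityˡ 0#)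

  ∑-pick : ∀ {a} {A : Set a} (_≟_ : DecidableEquality A) {L : List A} {z} (F : A → Carrier) →
           Unique L → z ∈ L → ∑ L (λ y → 𝟙[ y ≟ z ] F y) ≈ F z
  ∑-pick _≟_ {y ∷ L} F (y∉L ∷ _) (here ≡.refl) =
    trans (+-cong (𝟙-yes (y ≟ y) ≡.refl) (∑-vanish L (λ y′∈L → 𝟙-no (_ ≟ y) (All.lookup y∉L y′∈L ∘ ≡.sym))))
          (+-identityʳ _)
  ∑-pick _≟_ {y ∷ L} F (y∉L ∷ uL) (there z∈L) =
    trans (+-cong (𝟙-no (y ≟ _) (All.lookup y∉L z∈L)) (∑-pick _≟_ F uL z∈L)) (+-identityˡ _)

  ∑-filter : ∀ {a p} {A : Set a} {Q : Pred A p} (Q? : Decidable Q) (L : List A) (h : A → Carrier) →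
             ∑ (filter Q? L) h ≈ ∑ L (λ y → 𝟙[ Q? y ] h y)
  ∑-filter Q? []      h = refl
  ∑-filter Q? (y ∷ L) h with does (Q? y)
  ... | true  = +-congˡ (∑-filter Q? L h)
  ... | false = trans (∑-filter Q? L h) (sym (+-identityˡ _))

  ∑-filter-cong : ∀ {a p} {A : Set a} {Q : Pred A p} (Q? : Decidable Q) (L : List A) {h h′ : A → Carrier} →
                  (∀ y → Q y → h y ≈ h′ y) → ∑ (filter Q? L) h ≈ ∑ (filter Q? L) h′
  ∑-filter-cong Q? L {h} {h′} h≈h′ = trans (∑-filter Q? L h)
    (trans (∑-cong L (λ y → 𝟙-cong (Q? y) (h≈h′ y))) (sym (∑-filter Q? L h′)))

-- The strict order of P̂ and a height function on P̂ that strictly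
-- decreases along it; the height bounds the length of chains in P̂ and
-- hence justifies all the finite recursions below.
module HatOrder (P : FinPoset) where
  open FinPoset P
  open import Relation.Binary using (IsDecPartialOrder)
  open import Data.List.Membership.Propositional using (_∈_)
  open import Data.List.Membership.Propositional.Properties using (∈-allFin; ∈-map⁺; ∈-map⁻)
  open import Data.List.Relation.Unary.Unique.Propositional using (Unique)
  import Data.List.Relation.Unary.Unique.Propositional.Properties as Unique
  open import Data.List.Relation.Unary.AllPairs using (_∷_)
  import Data.List.Relation.Unary.All as All
  import Data.List.Relation.Unary.Any as Any
  open import Data.Fin.Properties using () renaming (_≟_ to _≟ᶠ_)
  module ≤ = IsDecPartialOrder isDecPartialOrder

  <-trans : ∀ {x y z} → x < y → y < z → x < z
  <-trans (x≤y , x≢y) (y≤z , _) =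
    ≤.trans x≤y y≤z , λ { ≡.refl → x≢y (≤.antisym x≤y y≤z) }

  <-irrefl : ∀ {x} → ¬ (x < x)
  <-irrefl (_ , x≢x) = x≢x ≡.refl

  <̂-trans : ∀ {x y z} → x <̂ y → y <̂ z → x <̂ z
  <̂-trans {bot}   {⟨ _ ⟩} {⟨ _ ⟩} _   _   = tt
  <̂-trans {bot}   {⟨ _ ⟩} {top}   _   _   = tt
  <̂-trans {⟨ _ ⟩} {⟨ _ ⟩} {⟨ _ ⟩} x<y y<z = <-trans x<y y<z
  <̂-trans {⟨ _ ⟩} {⟨ _ ⟩} {top}   _   _   = tt
  <̂-trans {_}     {top}   {bot}   _   ()
  <̂-trans {_}     {top}   {⟨ _ ⟩} _   ()
  <̂-trans {_}     {top}   {top}   _   ()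
  <̂-trans {bot}   {bot}   ()
  <̂-trans {⟨ _ ⟩} {bot}   ()
  <̂-trans {top}   {_}     ()

  <̂-irrefl : ∀ {x} → ¬ (x <̂ x)
  <̂-irrefl {bot}   ()
  <̂-irrefl {⟨ _ ⟩} x<x = <-irrefl x<x
  <̂-irrefl {top}   ()

  nothing-below-bot : ∀ {x} → ¬ (x <̂ bot)
  nothing-below-bot {bot}   ()
  nothing-below-bot {⟨ _ ⟩} ()
  nothing-below-bot {top}   ()

  _≟̂_ : DecidableEquality Hat
  bot   ≟̂ bot   = yes ≡.refl
  top   ≟̂ top   = yes ≡.refl
  ⟨ x ⟩ ≟̂ ⟨ y ⟩ with x ≟ᶠ y
  ... | yes ≡.refl = yes ≡.refl
  ... | no  x≢y    = no λ { ≡.refl → x≢y ≡.refl }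
  bot   ≟̂ ⟨ _ ⟩ = no λ ()
  bot   ≟̂ top   = no λ ()
  ⟨ _ ⟩ ≟̂ bot   = no λ ()
  ⟨ _ ⟩ ≟̂ top   = no λ ()
  top   ≟̂ bot   = no λ ()
  top   ≟̂ ⟨ _ ⟩ = no λ ()

  hatElems-unique : Unique hatElems
  hatElems-unique =
    All.tabulate (λ { (here ≡.refl) → λ () ; (there y∈) → bot≢ y∈ }) ∷
    All.tabulate (λ y∈ → top≢ y∈) ∷
    Unique.map⁺ (λ { ≡.refl → ≡.refl }) (Unique.allFin⁺ n)
    where
    bot≢ : ∀ {y} → y ∈ map ⟨_⟩ (allFin n) → ¬ (bot ≡ y)
    bot≢ y∈ bot≡y with ∈-map⁻ ⟨_⟩ y∈
    bot≢ y∈ ≡.refl | _ , _ , ()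
    top≢ : ∀ {y} → y ∈ map ⟨_⟩ (allFin n) → ¬ (top ≡ y)
    top≢ y∈ top≡y with ∈-map⁻ ⟨_⟩ y∈
    top≢ y∈ ≡.refl | _ , _ , ()

  ∈-hatElems : ∀ x → x ∈ hatElems
  ∈-hatElems bot   = here ≡.refl
  ∈-hatElems top   = there (here ≡.refl)
  ∈-hatElems ⟨ x ⟩ = there (there (∈-map⁺ ⟨_⟩ (∈-allFin x)))

  filter-length-mono : ∀ {p q} {A : Set} {Q : Pred A p} {R : Pred A q}
                       (Q? : Decidable Q) (R? : Decidable R) (L : List A) → (∀ z → Q z → R z) →
                       length (filter Q? L) ℕ.≤ length (filter R? L)
  filter-length-mono Q? R? []      Q⇒R = z≤n
  filter-length-mono Q? R? (z ∷ L) Q⇒R with Q? z | R? z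
  ... | yes q | yes _ = s≤s (filter-length-mono Q? R? L Q⇒R)
  ... | yes q | no ¬r = ⊥-elim (¬r (Q⇒R z q))
  ... | no _  | yes _ = ℕ.m≤n⇒m≤1+n (filter-length-mono Q? R? L Q⇒R)
  ... | no _  | no _  = filter-length-mono Q? R? L Q⇒R

  filter-length-strict : ∀ {p q} {A : Set} {Q : Pred A p} {R : Pred A q}
                         (Q? : Decidable Q) (R? : Decidable R) (L : List A) → (∀ z → Q z → R z) →
                         ∀ {w} → w ∈ L → R w → ¬ Q w → length (filter Q? L) ℕ.< length (filter R? L)
  filter-length-strict Q? R? (z ∷ L) Q⇒R (here ≡.refl) r ¬q with Q? z | R? z
  ... | yes q | _     = ⊥-elim (¬q q)
  ... | no _  | yes _ = s≤s (filter-length-mono Q? R? L Q⇒R)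
  ... | no _  | no ¬r = ⊥-elim (¬r r)
  filter-length-strict Q? R? (z ∷ L) Q⇒R (there w∈L) r ¬q with Q? z | R? z
  ... | yes q | yes _ = s≤s (filter-length-strict Q? R? L Q⇒R w∈L r ¬q)
  ... | yes q | no ¬r = ⊥-elim (¬r (Q⇒R z q))
  ... | no _  | yes _ = ℕ.m≤n⇒m≤1+n (filter-length-strict Q? R? L Q⇒R w∈L r ¬q)
  ... | no _  | no _  = filter-length-strict Q? R? L Q⇒R w∈L r ¬q

  #above : Fin n → ℕ
  #above x = length (filter (x <?_) (allFin n))

  #above<n : ∀ x → #above x ℕ.< n
  #above<n x = ℕ.<-≤-trans
    (List.filter-notAll (x <?_) (allFin n) (Any.map (λ { ≡.refl → <-irrefl }) (∈-allFin x)))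
    (ℕ.≤-reflexive (List.length-tabulate Function.id))

  #above-decreasing : ∀ {x y} → x < y → #above y ℕ.< #above x
  #above-decreasing {x} {y} x<y =
    filter-length-strict (y <?_) (x <?_) (allFin n) (λ _ → <-trans x<y) (∈-allFin y) x<y <-irrefl

  height : Hat → ℕ
  height bot   = ℕ.suc n
  height ⟨ x ⟩ = ℕ.suc (#above x)
  height top   = 0

  height-decreasing : ∀ {x y} → x <̂ y → height y ℕ.< height x
  height-decreasing {bot}   {⟨ y ⟩} _   = s≤s (#above<n y)
  height-decreasing {bot}   {top}   _   = s≤s z≤n
  height-decreasing {⟨ _ ⟩} {⟨ _ ⟩} x<y = s≤s (#above-decreasing x<y)
  height-decreasing {⟨ _ ⟩} {top}   _   = s≤s z≤n
  height-decreasing {bot}   {bot}   ()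
  height-decreasing {⟨ _ ⟩} {bot}   ()
  height-decreasing {top}   {_}     ()

  height≤ : ∀ x → height x ℕ.≤ ℕ.suc n
  height≤ bot   = ℕ.≤-refl
  height≤ ⟨ x ⟩ = s≤s (ℕ.<⇒≤ (#above<n x))
  height≤ top   = z≤n

  height-step : ∀ {x y k} → x ⋖ y → height x ℕ.≤ ℕ.suc k → height y ℕ.≤ k
  height-step x⋖y hx = ℕ.≤-pred (ℕ.≤-trans (height-decreasing (proj₁ x⋖y)) hx)

-- A labeling g weights the elements of P̂ (0̂ ↦ 0, 1̂ ↦ 1), and
-- the weighted cover matrix  step g x y = [x ⋖ y]·ĝ(y)  has powers
-- counting saturated chains.  path g x z is the total weight of the
-- saturated chains x ⋖ y₁ ⋖ ⋯ ⋖ yₘ = z (weights of y₁,…,yₘ multiplied),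
-- i.e. (N + N² + ⋯) x z for the nilpotent matrix N = step g.
module PathSums {c ℓ} (K : Field c ℓ) (P : FinPoset) where
  open Field K
  open FinPoset P
  open HatOrder P
  open ListSums commutativeSemiring
  open import Relation.Binary.Reasoning.Setoid setoid

  -- labelings of P (the type Birational.Labeling, which also fixes C)
  Labeling : Set c
  Labeling = Fin n → Carrier

  ĝ : Labeling → Hat → Carrier
  ĝ g bot   = 0#
  ĝ g ⟨ x ⟩ = g x
  ĝ g top   = 1#

  step : Labeling → Hat → Hat → Carrier
  step g x y = 𝟙[ x ⋖? y ] ĝ g y

  ∑̂ : (Hat → Carrier) → Carrier
  ∑̂ = ∑ hatElems

  ∑̂-step-cong : ∀ g g′ x {F F′ : Hat → Carrier} → (∀ w → x ⋖ w → ĝ g w * F w ≈ ĝ g′ w * F′ w) →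
                ∑̂ (λ w → step g x w * F w) ≈ ∑̂ (λ w → step g′ x w * F′ w)
  ∑̂-step-cong g g′ x {F} {F′} eq = ∑-cong hatElems (λ w →
    trans (𝟙-*ʳ (x ⋖? w) _ _) (trans (𝟙-cong (x ⋖? w) (eq w)) (sym (𝟙-*ʳ (x ⋖? w) _ _))))

  ∑̂-step-zero : ∀ g x {F : Hat → Carrier} → (∀ w → x ⋖ w → F w ≈ 0#) → ∑̂ (λ w → step g x w * F w) ≈ 0#
  ∑̂-step-zero g x {F} F≈0 = trans (∑̂-step-cong g g x (λ w x⋖w → *-congˡ (F≈0 w x⋖w)))
                                  (∑-zero hatElems (λ w → zeroʳ _))

  -- stepPower g j = (step g)^(j+1)
  stepPower : Labeling → ℕ → Hat → Hat → Carrier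
  stepPower g ℕ.zero    x z = step g x z
  stepPower g (ℕ.suc j) x z = ∑̂ (λ y → step g x y * stepPower g j y z)

  stepPower-nilpotent : ∀ g j x z → height x ℕ.≤ j → stepPower g j x z ≈ 0#
  stepPower-nilpotent g ℕ.zero    top     z _  = 𝟙-no (top ⋖? z) (λ ())
  stepPower-nilpotent g (ℕ.suc j) x       z hx =
    ∑̂-step-zero g x (λ w x⋖w → stepPower-nilpotent g j w z (height-step x⋖w hx))

  stepPower-vanish : ∀ g j x z → ¬ (x <̂ z) → stepPower g j x z ≈ 0#
  stepPower-vanish g ℕ.zero    x z x≮z = 𝟙-no (x ⋖? z) (x≮z ∘ proj₁)
  stepPower-vanish g (ℕ.suc j) x z x≮z =
    ∑̂-step-zero g x (λ w x⋖w → stepPower-vanish g j w z (x≮z ∘ <̂-trans (proj₁ x⋖w)))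

  stepPower-last : ∀ g j x z → stepPower g (ℕ.suc j) x z ≈ ∑̂ (λ y → stepPower g j x y * step g y z)
  stepPower-last g ℕ.zero    x z = refl
  stepPower-last g (ℕ.suc j) x z = begin
      ∑̂ (λ y → step g x y * stepPower g (ℕ.suc j) y z)
        ≈⟨ ∑-cong hatElems (λ y → *-congˡ (stepPower-last g j y z)) ⟩
      ∑̂ (λ y → step g x y * ∑̂ (λ w → stepPower g j y w * step g w z))
        ≈⟨ ∑-cong hatElems (λ y → sym (∑-*ˡ hatElems (step g x y) _)) ⟩
      ∑̂ (λ y → ∑̂ (λ w → step g x y * (stepPower g j y w * step g w z)))
        ≈⟨ ∑-swap hatElems hatElems _ ⟩
      ∑̂ (λ w → ∑̂ (λ y → step g x y * (stepPower g j y w * step g w z)))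
        ≈⟨ ∑-cong hatElems (λ w → trans (∑-cong hatElems (λ y → sym (*-assoc _ _ _)))
                                         (∑-*ʳ hatElems (step g w z) _)) ⟩
      ∑̂ (λ w → stepPower g (ℕ.suc j) x w * step g w z) ∎

  pathsUpTo : Labeling → ℕ → Hat → Hat → Carrier
  pathsUpTo g ℕ.zero    x z = 0#
  pathsUpTo g (ℕ.suc k) x z = pathsUpTo g k x z + stepPower g k x z

  pathsUpTo-first : ∀ g k x z →
    pathsUpTo g (ℕ.suc k) x z ≈ step g x z + ∑̂ (λ y → step g x y * pathsUpTo g k y z)
  pathsUpTo-first g ℕ.zero x z =
    trans (+-identityˡ _) (sym (trans (+-congˡ (∑-zero hatElems (λ y → zeroʳ _))) (+-identityʳ _)))
  pathsUpTo-first g (ℕ.suc k) x z = begin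
      pathsUpTo g (ℕ.suc k) x z + stepPower g (ℕ.suc k) x z
        ≈⟨ +-congʳ (pathsUpTo-first g k x z) ⟩
      (step g x z + ∑̂ (λ y → step g x y * pathsUpTo g k y z)) + ∑̂ (λ y → step g x y * stepPower g k y z)
        ≈⟨ +-assoc _ _ _ ⟩
      step g x z + (∑̂ (λ y → step g x y * pathsUpTo g k y z) + ∑̂ (λ y → step g x y * stepPower g k y z))
        ≈⟨ +-congˡ (sym (∑-+ hatElems _ _)) ⟩
      step g x z + ∑̂ (λ y → step g x y * pathsUpTo g k y z + step g x y * stepPower g k y z)
        ≈⟨ +-congˡ (∑-cong hatElems (λ y → sym (distribˡ _ _ _))) ⟩
      step g x z + ∑̂ (λ y → step g x y * pathsUpTo g (ℕ.suc k) y z) ∎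

  pathsUpTo-last : ∀ g k x z →
    pathsUpTo g (ℕ.suc k) x z ≈ step g x z + ∑̂ (λ y → pathsUpTo g k x y * step g y z)
  pathsUpTo-last g ℕ.zero x z =
    trans (+-identityˡ _) (sym (trans (+-congˡ (∑-zero hatElems (λ y → zeroˡ _))) (+-identityʳ _)))
  pathsUpTo-last g (ℕ.suc k) x z = begin
      pathsUpTo g (ℕ.suc k) x z + stepPower g (ℕ.suc k) x z
        ≈⟨ +-cong (pathsUpTo-last g k x z) (stepPower-last g k x z) ⟩
      (step g x z + ∑̂ (λ y → pathsUpTo g k x y * step g y z)) + ∑̂ (λ y → stepPower g k x y * step g y z)
        ≈⟨ +-assoc _ _ _ ⟩
      step g x z + (∑̂ (λ y → pathsUpTo g k x y * step g y z) + ∑̂ (λ y → stepPower g k x y * step g y z))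
        ≈⟨ +-congˡ (sym (∑-+ hatElems _ _)) ⟩
      step g x z + ∑̂ (λ y → pathsUpTo g k x y * step g y z + stepPower g k x y * step g y z)
        ≈⟨ +-congˡ (∑-cong hatElems (λ y → sym (distribʳ _ _ _))) ⟩
      step g x z + ∑̂ (λ y → pathsUpTo g (ℕ.suc k) x y * step g y z) ∎

  pathsUpTo-stable : ∀ g k x z → height x ℕ.≤ k → pathsUpTo g (ℕ.suc k) x z ≈ pathsUpTo g k x z
  pathsUpTo-stable g k x z hx = trans (+-congˡ (stepPower-nilpotent g k x z hx)) (+-identityʳ _)

  pathsUpTo-vanish : ∀ g k x z → ¬ (x <̂ z) → pathsUpTo g k x z ≈ 0#
  pathsUpTo-vanish g ℕ.zero    x z _   = refl
  pathsUpTo-vanish g (ℕ.suc k) x z x≮z =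
    trans (+-cong (pathsUpTo-vanish g k x z x≮z) (stepPower-vanish g k x z x≮z)) (+-identityˡ 0#)

  -- all chains have at most height 0̂ = n+1 steps
  path : Labeling → Hat → Hat → Carrier
  path g = pathsUpTo g (ℕ.suc n)

  path-first : ∀ g x z → path g x z ≈ step g x z + ∑̂ (λ y → step g x y * path g y z)
  path-first g x z = trans (sym (pathsUpTo-stable g (ℕ.suc n) x z (height≤ x))) (pathsUpTo-first g (ℕ.suc n) x z)

  path-last : ∀ g x z → path g x z ≈ step g x z + ∑̂ (λ y → path g x y * step g y z)
  path-last g x z = trans (sym (pathsUpTo-stable g (ℕ.suc n) x z (height≤ x))) (pathsUpTo-last g (ℕ.suc n) x z)

  path-vanish : ∀ g x z → ¬ (x <̂ z) → path g x z ≈ 0#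
  path-vanish g = pathsUpTo-vanish g (ℕ.suc n)

  -- Kronecker delta of P̂; it lets "the step itself" and "a step followed by
  -- a path" be written as a single sum over the covers
  δ : Hat → Hat → Carrier
  δ x y = 𝟙[ x ≟̂ y ] 1#

  ∑̂-δʳ : ∀ (F : Hat → Carrier) z → ∑̂ (λ y → F y * δ y z) ≈ F z
  ∑̂-δʳ F z = trans (∑-cong hatElems (λ y →
                      trans (𝟙-*ˡ (y ≟̂ z) 1# (F y)) (𝟙-cong (y ≟̂ z) (λ _ → *-identityʳ _))))
                   (∑-pick _≟̂_ F hatElems-unique (∈-hatElems z))

  ∑̂-δˡ : ∀ (F : Hat → Carrier) x → ∑̂ (λ y → δ x y * F y) ≈ F x
  ∑̂-δˡ F x = trans (∑-cong hatElems (λ y → trans (*-comm _ _) (*-congˡ (𝟙-⇔ (x ≟̂ y) (y ≟̂ x) ≡.sym ≡.sym))))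
                   (∑̂-δʳ F x)

  path-first′ : ∀ g x z → path g x z ≈ ∑̂ (λ y → 𝟙[ x ⋖? y ] (ĝ g y * (δ y z + path g y z)))
  path-first′ g x z = begin
      path g x z
        ≈⟨ path-first g x z ⟩
      step g x z + ∑̂ (λ y → step g x y * path g y z)
        ≈⟨ +-congʳ (sym (∑̂-δʳ (step g x) z)) ⟩
      ∑̂ (λ y → step g x y * δ y z) + ∑̂ (λ y → step g x y * path g y z)
        ≈⟨ sym (∑-+ hatElems _ _) ⟩
      ∑̂ (λ y → step g x y * δ y z + step g x y * path g y z)
        ≈⟨ ∑-cong hatElems (λ y → trans (sym (distribˡ _ _ _)) (𝟙-*ʳ (x ⋖? y) _ _)) ⟩
      ∑̂ (λ y → 𝟙[ x ⋖? y ] (ĝ g y * (δ y z + path g y z))) ∎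

  path-last′ : ∀ g x z → path g x z ≈ ∑̂ (λ y → (δ x y + path g x y) * step g y z)
  path-last′ g x z = begin
      path g x z
        ≈⟨ path-last g x z ⟩
      step g x z + ∑̂ (λ y → path g x y * step g y z)
        ≈⟨ +-congʳ (sym (∑̂-δˡ (λ y → step g y z) x)) ⟩
      ∑̂ (λ y → δ x y * step g y z) + ∑̂ (λ y → path g x y * step g y z)
        ≈⟨ sym (∑-+ hatElems _ _) ⟩
      ∑̂ (λ y → δ x y * step g y z + path g x y * step g y z)
        ≈⟨ ∑-cong hatElems (λ y → sym (distribʳ _ _ _)) ⟩
      ∑̂ (λ y → (δ x y + path g x y) * step g y z) ∎

module ChainSums {c ℓ} (K : Field c ℓ) (P : FinPoset) where
  open Field K
  open FinPoset P
  open HatOrder P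
  open PathSums K P
  open ListSums commutativeSemiring
  open import Data.List.Membership.Propositional using (_∈_)
  open import Data.Fin.Properties using () renaming (_≟_ to _≟ᶠ_)
  open import Data.List.Membership.DecPropositional (_≟ᶠ_ {n}) using (_∈?_)
  open import Relation.Binary.Reasoning.Setoid setoid

  chainWeight : Labeling → List (Fin n) → Carrier
  chainWeight g ys = Data.List.foldr _*_ 1# (map g ys)

  chainsVia : ℕ → Hat → List (List (Fin n))
  chainsVia k bot   = []
  chainsVia k ⟨ y ⟩ = map (y ∷_) (chainsFrom k ⟨ y ⟩)
  chainsVia k top   = [] ∷ []

  chainsFrom-unfold : ∀ k x → chainsFrom (ℕ.suc k) x ≡ concatMap (chainsVia k) (filter (x ⋖?_) hatElems)
  chainsFrom-unfold k x =
    List.concatMap-cong (λ { bot → ≡.refl ; ⟨ _ ⟩ → ≡.refl ; top → ≡.refl }) (filter (x ⋖?_) hatElems)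

  ∑-chainsFrom : ∀ k x (F : List (Fin n) → Carrier) (t : Hat → Carrier) →
                 (∀ y → x ⋖ y → ∑ (chainsVia k y) F ≈ t y) →
                 ∑ (chainsFrom (ℕ.suc k) x) F ≈ ∑̂ (λ y → 𝟙[ x ⋖? y ] t y)
  ∑-chainsFrom k x F t first = begin
      ∑ (chainsFrom (ℕ.suc k) x) F
        ≡⟨ ≡.cong (λ L → ∑ L F) (chainsFrom-unfold k x) ⟩
      ∑ (concatMap (chainsVia k) (filter (x ⋖?_) hatElems)) F
        ≈⟨ ∑-concatMap (chainsVia k) (filter (x ⋖?_) hatElems) F ⟩
      ∑ (filter (x ⋖?_) hatElems) (λ y → ∑ (chainsVia k y) F)
        ≈⟨ ∑-filter (x ⋖?_) hatElems _ ⟩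
      ∑̂ (λ y → 𝟙[ x ⋖? y ] ∑ (chainsVia k y) F)
        ≈⟨ ∑-cong hatElems (λ y → 𝟙-cong (x ⋖? y) (first y)) ⟩
      ∑̂ (λ y → 𝟙[ x ⋖? y ] t y) ∎

  chains-path : ∀ g k x → height x ℕ.≤ k → ∑ (chainsFrom k x) (chainWeight g) ≈ path g x top
  chains-path g ℕ.zero    top hx = sym (path-vanish g top top (λ ()))
  chains-path g (ℕ.suc k) x   hx =
    trans (∑-chainsFrom k x (chainWeight g) _ via) (sym (path-first′ g x top))
    where
    via : ∀ y → x ⋖ y → ∑ (chainsVia k y) (chainWeight g) ≈ ĝ g y * (δ y top + path g y top)
    via bot   x⋖y = ⊥-elim (nothing-below-bot (proj₁ x⋖y))
    via top   x⋖y = trans (+-identityʳ 1#) (sym (trans (*-identityˡ _)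
                      (trans (+-congˡ (path-vanish g top top (λ ()))) (+-identityʳ 1#))))
    via ⟨ i ⟩ x⋖y = begin
      ∑ (map (i ∷_) (chainsFrom k ⟨ i ⟩)) (chainWeight g)
        ≡⟨ ∑-map (i ∷_) (chainsFrom k ⟨ i ⟩) (chainWeight g) ⟩
      ∑ (chainsFrom k ⟨ i ⟩) (λ ys → g i * chainWeight g ys)
        ≈⟨ ∑-*ˡ (chainsFrom k ⟨ i ⟩) (g i) (chainWeight g) ⟩
      g i * ∑ (chainsFrom k ⟨ i ⟩) (chainWeight g)
        ≈⟨ *-congˡ (chains-path g k ⟨ i ⟩ (height-step x⋖y hx)) ⟩
      g i * path g ⟨ i ⟩ top
        ≈⟨ *-congˡ (sym (+-identityˡ _)) ⟩
      g i * (0# + path g ⟨ i ⟩ top) ∎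

  chains-through : ∀ g v k x → height x ℕ.≤ k →
                   ∑ (chainsFrom k x) (λ ys → 𝟙[ v ∈? ys ] chainWeight g ys) ≈ path g x ⟨ v ⟩ * path g ⟨ v ⟩ top
  chains-through g v ℕ.zero top hx = sym (trans (*-congʳ (path-vanish g top ⟨ v ⟩ (λ ()))) (zeroˡ _))
  chains-through g v (ℕ.suc k) x hx = begin
      ∑ (chainsFrom (ℕ.suc k) x) (λ ys → 𝟙[ v ∈? ys ] chainWeight g ys)
        ≈⟨ ∑-chainsFrom k x _ (λ y → ĝ g y * (δ y ⟨ v ⟩ + path g y ⟨ v ⟩) * U) via ⟩
      ∑̂ (λ y → 𝟙[ x ⋖? y ] (ĝ g y * (δ y ⟨ v ⟩ + path g y ⟨ v ⟩) * U))
        ≈⟨ ∑-cong hatElems (λ y → sym (𝟙-*ʳ (x ⋖? y) _ U)) ⟩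
      ∑̂ (λ y → 𝟙[ x ⋖? y ] (ĝ g y * (δ y ⟨ v ⟩ + path g y ⟨ v ⟩)) * U)
        ≈⟨ ∑-*ʳ hatElems U _ ⟩
      ∑̂ (λ y → 𝟙[ x ⋖? y ] (ĝ g y * (δ y ⟨ v ⟩ + path g y ⟨ v ⟩))) * U
        ≈⟨ *-congʳ (sym (path-first′ g x ⟨ v ⟩)) ⟩
      path g x ⟨ v ⟩ * U ∎
    where
    U = path g ⟨ v ⟩ top
    viaElement : ∀ i → height ⟨ i ⟩ ℕ.≤ k → Dec (i ≡ v) →
                 ∑ (chainsFrom k ⟨ i ⟩) (λ ys → 𝟙[ v ∈? (i ∷ ys) ] chainWeight g (i ∷ ys)) ≈
                 g i * ((δ ⟨ i ⟩ ⟨ v ⟩ + path g ⟨ i ⟩ ⟨ v ⟩) * U)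
    viaElement i hi (yes ≡.refl) = begin
        ∑ (chainsFrom k ⟨ i ⟩) (λ ys → 𝟙[ i ∈? (i ∷ ys) ] chainWeight g (i ∷ ys))
          ≈⟨ ∑-cong (chainsFrom k ⟨ i ⟩) (λ ys → 𝟙-yes (i ∈? (i ∷ ys)) (here ≡.refl)) ⟩
        ∑ (chainsFrom k ⟨ i ⟩) (λ ys → g i * chainWeight g ys)
          ≈⟨ ∑-*ˡ (chainsFrom k ⟨ i ⟩) (g i) (chainWeight g) ⟩
        g i * ∑ (chainsFrom k ⟨ i ⟩) (chainWeight g)
          ≈⟨ *-congˡ (chains-path g k ⟨ i ⟩ hi) ⟩
        g i * U
          ≈⟨ *-congˡ (sym (trans (*-congʳ δ+path≈1) (*-identityˡ U))) ⟩
        g i * ((δ ⟨ i ⟩ ⟨ i ⟩ + path g ⟨ i ⟩ ⟨ i ⟩) * U) ∎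
      where
      δ+path≈1 : δ ⟨ i ⟩ ⟨ i ⟩ + path g ⟨ i ⟩ ⟨ i ⟩ ≈ 1#
      δ+path≈1 = trans (+-cong (𝟙-yes (⟨ i ⟩ ≟̂ ⟨ i ⟩) ≡.refl) (path-vanish g ⟨ i ⟩ ⟨ i ⟩ <̂-irrefl))
                       (+-identityʳ 1#)
    viaElement i hi (no i≢v) = begin
        ∑ (chainsFrom k ⟨ i ⟩) (λ ys → 𝟙[ v ∈? (i ∷ ys) ] chainWeight g (i ∷ ys))
          ≈⟨ ∑-cong (chainsFrom k ⟨ i ⟩) (λ ys → trans (𝟙-⇔ (v ∈? (i ∷ ys)) (v ∈? ys) (skip ys) there)
                                                        (sym (𝟙-*ˡ (v ∈? ys) _ (g i)))) ⟩
        ∑ (chainsFrom k ⟨ i ⟩) (λ ys → g i * 𝟙[ v ∈? ys ] chainWeight g ys)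
          ≈⟨ ∑-*ˡ (chainsFrom k ⟨ i ⟩) (g i) _ ⟩
        g i * ∑ (chainsFrom k ⟨ i ⟩) (λ ys → 𝟙[ v ∈? ys ] chainWeight g ys)
          ≈⟨ *-congˡ (chains-through g v k ⟨ i ⟩ hi) ⟩
        g i * (path g ⟨ i ⟩ ⟨ v ⟩ * U)
          ≈⟨ *-congˡ (*-congʳ (sym (trans (+-congʳ (𝟙-no (⟨ i ⟩ ≟̂ ⟨ v ⟩) λ { ≡.refl → i≢v ≡.refl }))
                                          (+-identityˡ _)))) ⟩
        g i * ((δ ⟨ i ⟩ ⟨ v ⟩ + path g ⟨ i ⟩ ⟨ v ⟩) * U) ∎
      where
      skip : ∀ ys → v ∈ (i ∷ ys) → v ∈ ys
      skip ys (here v≡i) = ⊥-elim (i≢v (≡.sym v≡i))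
      skip ys (there v∈ys) = v∈ys
    via : ∀ y → x ⋖ y → ∑ (chainsVia k y) (λ ys → 𝟙[ v ∈? ys ] chainWeight g ys) ≈
                         ĝ g y * (δ y ⟨ v ⟩ + path g y ⟨ v ⟩) * U
    via bot   x⋖y = ⊥-elim (nothing-below-bot (proj₁ x⋖y))
    via top   x⋖y = trans (+-identityʳ _) (trans (𝟙-no (v ∈? []) {1#} (λ ()))
                      (sym (trans (*-congʳ (trans (*-identityˡ _) (trans (+-identityˡ _) (path-vanish g top ⟨ v ⟩ (λ ())))))
                                  (zeroˡ U))))
    via ⟨ i ⟩ x⋖y = trans (reflexive (∑-map (i ∷_) (chainsFrom k ⟨ i ⟩) _))
                      (trans (viaElement i (height-step x⋖y hx) (i ≟ᶠ v)) (sym (*-assoc _ _ _)))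

  Δsum : Labeling → Fin n → Carrier
  Δsum g x = ∑ (chainsFrom (ℕ.suc n) ⟨ x ⟩) (λ ys → chainWeight g (x ∷ ys))

  pathAbove pathBelow : Labeling → Fin n → Carrier
  pathAbove g y = path g ⟨ y ⟩ top
  pathBelow g y = path g bot ⟨ y ⟩

  Δsum-factor : ∀ g x → Δsum g x ≈ g x * pathAbove g x
  Δsum-factor g x = trans (∑-*ˡ (chainsFrom (ℕ.suc n) ⟨ x ⟩) (g x) (chainWeight g))
                          (*-congˡ (chains-path g (ℕ.suc n) ⟨ x ⟩ (height≤ ⟨ x ⟩)))

  maximalChains-through : ∀ g v →
    ∑ (filter (v ∈?_) maximalChains) (chainWeight g) ≈ pathBelow g v * pathAbove g v
  maximalChains-through g v =
    trans (∑-filter (v ∈?_) maximalChains (chainWeight g)) (chains-through g v (ℕ.suc n) bot ℕ.≤-refl)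

  Δ̂sum : Labeling → Hat → Carrier
  Δ̂sum g bot   = 0#
  Δ̂sum g ⟨ y ⟩ = Δsum g y
  Δ̂sum g top   = 1#

  pathBeloŵ : Labeling → Hat → Carrier
  pathBeloŵ g bot   = 1#
  pathBeloŵ g ⟨ y ⟩ = pathBelow g y
  pathBeloŵ g top   = 0#

  pathAbove-recursion : ∀ g x → pathAbove g x ≈ ∑ (filter (⟨ x ⟩ ⋖?_) hatElems) (Δ̂sum g)
  pathAbove-recursion g x =
    trans (path-first′ g ⟨ x ⟩ top)
          (trans (∑-cong hatElems (λ w → 𝟙-cong (⟨ x ⟩ ⋖? w) (cover w)))
                 (sym (∑-filter (⟨ x ⟩ ⋖?_) hatElems (Δ̂sum g))))
    where
    cover : ∀ w → ⟨ x ⟩ ⋖ w → ĝ g w * (δ w top + path g w top) ≈ Δ̂sum g w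
    cover bot   x⋖w = ⊥-elim (nothing-below-bot {⟨ x ⟩} (proj₁ x⋖w))
    cover top   _   = trans (*-identityˡ _) (trans (+-congˡ (path-vanish g top top (λ ()))) (+-identityʳ 1#))
    cover ⟨ i ⟩ _   = trans (*-congˡ (+-identityˡ _)) (sym (Δsum-factor g i))

  pathBelow-recursion : ∀ g x → pathBelow g x ≈ g x * ∑ (filter (_⋖? ⟨ x ⟩) hatElems) (pathBeloŵ g)
  pathBelow-recursion g x = begin
      path g bot ⟨ x ⟩
        ≈⟨ path-last′ g bot ⟨ x ⟩ ⟩
      ∑̂ (λ w → (δ bot w + path g bot w) * step g w ⟨ x ⟩)
        ≈⟨ ∑-cong hatElems (λ w → trans (*-comm _ _) (trans (𝟙-*ʳ (w ⋖? ⟨ x ⟩) _ _)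
             (trans (𝟙-cong (w ⋖? ⟨ x ⟩) (λ w⋖x → *-congˡ (cover w w⋖x))) (sym (𝟙-*ˡ (w ⋖? ⟨ x ⟩) _ _))))) ⟩
      ∑̂ (λ w → g x * 𝟙[ w ⋖? ⟨ x ⟩ ] pathBeloŵ g w)
        ≈⟨ ∑-*ˡ hatElems (g x) _ ⟩
      g x * ∑̂ (λ w → 𝟙[ w ⋖? ⟨ x ⟩ ] pathBeloŵ g w)
        ≈⟨ *-congˡ (sym (∑-filter (_⋖? ⟨ x ⟩) hatElems (pathBeloŵ g))) ⟩
      g x * ∑ (filter (_⋖? ⟨ x ⟩) hatElems) (pathBeloŵ g) ∎
    where
    cover : ∀ w → w ⋖ ⟨ x ⟩ → δ bot w + path g bot w ≈ pathBeloŵ g w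
    cover bot   _   = trans (+-congˡ (path-vanish g bot bot (λ ()))) (+-identityʳ 1#)
    cover ⟨ i ⟩ _   = +-identityˡ _
    cover top   w⋖x = ⊥-elim (proj₁ w⋖x)

  -- Locality: if g′ agrees with g away from v, path sums starting at a point
  -- y ≰ v of P̂ do not see the difference (all their chains avoid v).
  module Locality (v : Fin n) (g g′ : Labeling) (agree : ∀ x → ¬ (x ≡ v) → g′ x ≈ g x) where

    NotBelow : Hat → Set
    NotBelow y = ¬ (y ≡ ⟨ v ⟩) × ¬ (y <̂ ⟨ v ⟩)

    notBelow-step : ∀ {y w} → NotBelow y → y ⋖ w → NotBelow w
    notBelow-step (y≢v , y≮v) y⋖w = (λ { ≡.refl → y≮v (proj₁ y⋖w) }) , (y≮v ∘ <̂-trans (proj₁ y⋖w))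

    ĝ-agree : ∀ y → ¬ (y ≡ ⟨ v ⟩) → ĝ g′ y ≈ ĝ g y
    ĝ-agree bot   _   = refl
    ĝ-agree top   _   = refl
    ĝ-agree ⟨ x ⟩ x≢v = agree x (x≢v ∘ ≡.cong ⟨_⟩)

    stepPower-local : ∀ j y z → NotBelow y → stepPower g′ j y z ≈ stepPower g j y z
    stepPower-local ℕ.zero    y z y≰v = 𝟙-cong (y ⋖? z) (λ y⋖z → ĝ-agree z (proj₁ (notBelow-step y≰v y⋖z)))
    stepPower-local (ℕ.suc j) y z y≰v = ∑̂-step-cong g′ g y (λ w y⋖w →
      *-cong (ĝ-agree w (proj₁ (notBelow-step y≰v y⋖w))) (stepPower-local j w z (notBelow-step y≰v y⋖w)))

    path-local : ∀ y z → NotBelow y → path g′ y z ≈ path g y z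
    path-local y z y≰v = pathsUpTo-local (ℕ.suc n)
      where
      pathsUpTo-local : ∀ k → pathsUpTo g′ k y z ≈ pathsUpTo g k y z
      pathsUpTo-local ℕ.zero    = refl
      pathsUpTo-local (ℕ.suc k) = +-cong (pathsUpTo-local k) (stepPower-local k y z y≰v)

    Δsum-local : ∀ x → ¬ (x ≡ v) → ¬ (x < v) → Δsum g′ x ≈ Δsum g x
    Δsum-local x x≢v x≮v = trans (Δsum-factor g′ x)
      (trans (*-cong (agree x x≢v) (path-local ⟨ x ⟩ top ((x≢v ∘ ⟨⟩-injective) , x≮v)))
             (sym (Δsum-factor g x)))
      where
      ⟨⟩-injective : ∀ {a b} → ⟨ a ⟩ ≡ ⟨ b ⟩ → a ≡ b
      ⟨⟩-injective ≡.refl = ≡.refl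

    -- the elements covering v are not below v, so the label at v itself is
    -- the only one not seen by pathAbove
    pathAbove-local : pathAbove g′ v ≈ pathAbove g v
    pathAbove-local =
      trans (path-first g′ ⟨ v ⟩ top) (trans (+-congˡ (∑̂-step-cong g′ g ⟨ v ⟩ cover)) (sym (path-first g ⟨ v ⟩ top)))
      where
      cover : ∀ w → ⟨ v ⟩ ⋖ w → ĝ g′ w * path g′ w top ≈ ĝ g w * path g w top
      cover w v⋖w = *-cong (ĝ-agree w (proj₁ w≰v)) (path-local w top w≰v)
        where
        w≰v : NotBelow w
        w≰v = (λ { ≡.refl → <̂-irrefl (proj₁ v⋖w) }) , (λ w<v → <̂-irrefl (<̂-trans (proj₁ v⋖w) w<v))

module Toggle {c ℓ} (K : Field c ℓ) (P : FinPoset) (C : Field.Carrier K) where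
  open Field K
  open FinPoset P
  open Birational K P C
  open FieldFacts K
  open ListSums commutativeSemiring
  open ChainSums K P
  open HatOrder P using (nothing-below-bot)
  open import Data.Fin.Properties using () renaming (_≟_ to _≟ᶠ_)
  open import Data.List.Membership.Propositional using (_∈_)
  open import Data.List.Membership.DecPropositional (_≟ᶠ_ {n}) using (_∈?_)
  open import Relation.Nullary.Decidable using (dec-true; dec-false)
  open import Relation.Binary.Reasoning.Setoid setoid
  open import Algebra.Solver.Ring.NaturalCoefficients.Default commutativeSemiring

  mix : ∀ {Q : Fin n → Set} → Decidable Q → Labeling → Labeling → Labeling
  mix Q? p q y = if does (Q? y) then p y else q y

  mix-in : ∀ {Q : Fin n → Set} (Q? : Decidable Q) p q {y} → Q y → mix Q? p q y ≡ p y
  mix-in Q? p q {y} Qy = ≡.cong (λ b → if b then p y else q y) (dec-true (Q? y) Qy)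

  mix-out : ∀ {Q : Fin n → Set} (Q? : Decidable Q) p q {y} → ¬ Q y → mix Q? p q y ≡ q y
  mix-out Q? p q {y} ¬Qy = ≡.cong (λ b → if b then p y else q y) (dec-false (Q? y) ¬Qy)

  update-here : ∀ f u a → update f u a u ≡ a
  update-here f u a = mix-in (_≟ᶠ u) (λ _ → a) f ≡.refl

  update-elsewhere : ∀ f u a {y} → ¬ (y ≡ u) → update f u a y ≡ f y
  update-elsewhere f u a = mix-out (_≟ᶠ u) (λ _ → a) f

  -- setting the label at a to p a moves a from the q-region to the p-region
  update-mix : ∀ {Q R : Fin n → Set} (Q? : Decidable Q) (R? : Decidable R) {p q lab : Labeling} {a b} →
               lab ≋ mix Q? p q → b ≈ p a → R a →
               (∀ y → ¬ (y ≡ a) → R y → Q y) → (∀ y → Q y → R y) →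
               update lab a b ≋ mix R? p q
  update-mix {Q} {R} Q? R? {p} {q} {lab} {a} {b} lab≋ b≈pa Ra R⇒Q Q⇒R y = byCase (y ≟ᶠ a)
    where
    byCase : Dec (y ≡ a) → update lab a b y ≈ mix R? p q y
    byCase (yes ≡.refl) = trans (reflexive (update-here lab a b)) (trans b≈pa (reflexive (≡.sym (mix-in R? p q Ra))))
    byCase (no y≢a) = trans (reflexive (update-elsewhere lab a b y≢a)) (trans (lab≋ y) (reflexive (same (Q? y) (R? y))))
      where
      same : Dec (Q y) → Dec (R y) → mix Q? p q y ≡ mix R? p q y
      same (yes Qy) _        = ≡.trans (mix-in Q? p q Qy) (≡.sym (mix-in R? p q (Q⇒R y Qy)))
      same (no ¬Qy) (yes Ry) = ⊥-elim (¬Qy (R⇒Q y y≢a Ry))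
      same (no ¬Qy) (no ¬Ry) = ≡.trans (mix-out Q? p q ¬Qy) (≡.sym (mix-out R? p q ¬Ry))

  belowSum aboveSum : Labeling → Fin n → Carrier
  belowSum f u = ∑ (filter (_⋖? ⟨ u ⟩) hatElems) (ext f)
  aboveSum f u = ∑ (filter (⟨ u ⟩ ⋖?_) hatElems) (λ y → 1# * ext f y ⁻¹)

  toggled : Labeling → Fin n → Carrier
  toggled f u = belowSum f u * (f u * aboveSum f u) ⁻¹

  T-closed-form : ∀ f u (d : Def (T u f)) →
                  ¬ (f u * aboveSum f u ≈ 0#) × (∀ y → val (T u f) d y ≡ update f u (toggled f u) y)
  T-closed-form f u (d , f·above≉0 , _) =
    ≡.subst (λ s → ¬ (f u * s ≈ 0#)) (sumP-val (filter (⟨ u ⟩ ⋖?_) hatElems) d) f·above≉0 ,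
    λ y → ≡.cong (λ s → update f u (belowSum f u * (f u * s) ⁻¹) y) (sumP-val (filter (⟨ u ⟩ ⋖?_) hatElems) d)
    where
    sumP-val : ∀ (L : List Hat) (d : Def (sumP (map (λ y → 1# ÷ ext f y) L))) →
               val (sumP (map (λ y → 1# ÷ ext f y) L)) d ≡ ∑ L (λ y → 1# * ext f y ⁻¹)
    sumP-val []      d             = ≡.refl
    sumP-val (y ∷ L) (_ , d , _) = ≡.cong (1# * ext f y ⁻¹ +_) (sumP-val L d)

  toggle-moves : ∀ {p q} lab a M (e : Def (T a lab)) → lab ≋ mix (_∈? M) p q → toggled lab a ≈ p a →
                 val (T a lab) e ≋ mix (_∈? (a ∷ M)) p q
  toggle-moves lab a M e lab≋ new≈ y =
    trans (reflexive (proj₂ (T-closed-form lab a e) y))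
          (update-mix (_∈? M) (_∈? (a ∷ M)) lab≋ new≈ (here ≡.refl) skipHead (λ _ → there) y)
    where
    skipHead : ∀ y → ¬ (y ≡ a) → y ∈ a ∷ M → y ∈ M
    skipHead y y≢a (here y≡a)  = ⊥-elim (y≢a y≡a)
    skipHead y y≢a (there y∈M) = y∈M

  belowSum-value : ∀ g f u → (∀ y → y < u → f y ≈ pathBelow g y) →
                   belowSum f u ≈ ∑ (filter (_⋖? ⟨ u ⟩) hatElems) (pathBeloŵ g)
  belowSum-value g f u below = ∑-filter-cong (_⋖? ⟨ u ⟩) hatElems λ
    { bot _ → refl ; ⟨ y ⟩ y⋖u → below y (proj₁ y⋖u) ; top t⋖u → ⊥-elim (proj₁ t⋖u) }

  aboveSum-value : ∀ h f u → ¬ (C ≈ 0#) → (∀ y → ¬ (Δsum h y ≈ 0#)) →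
                   (∀ y → u < y → f y ≈ C * Δsum h y ⁻¹) → aboveSum f u ≈ pathAbove h u * C ⁻¹
  aboveSum-value h f u C≉0 Δh≉0 above = begin
      aboveSum f u
        ≈⟨ ∑-filter-cong (⟨ u ⟩ ⋖?_) hatElems cover ⟩
      ∑ (filter (⟨ u ⟩ ⋖?_) hatElems) (λ w → Δ̂sum h w * C ⁻¹)
        ≈⟨ ∑-*ʳ (filter (⟨ u ⟩ ⋖?_) hatElems) (C ⁻¹) (Δ̂sum h) ⟩
      ∑ (filter (⟨ u ⟩ ⋖?_) hatElems) (Δ̂sum h) * C ⁻¹
        ≈⟨ *-congʳ (sym (pathAbove-recursion h u)) ⟩
      pathAbove h u * C ⁻¹ ∎
    where
    cover : ∀ w → ⟨ u ⟩ ⋖ w → 1# * ext f w ⁻¹ ≈ Δ̂sum h w * C ⁻¹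
    cover bot   u⋖b = ⊥-elim (nothing-below-bot {⟨ u ⟩} (proj₁ u⋖b))
    cover ⟨ y ⟩ u⋖y = trans (*-identityˡ _) (⁻¹-quotient C≉0 (Δh≉0 y) (above y (proj₁ u⋖y)))
    cover top   _   = refl

  toggle-value : ∀ (g h f : Labeling) u {b} → ¬ (C ≈ 0#) → (∀ y → ¬ (Δsum h y ≈ 0#)) → h u ≈ g u →
                 (∀ y → y < u → f y ≈ pathBelow g y) →
                 (∀ y → u < y → f y ≈ C * Δsum h y ⁻¹) →
                 ¬ (f u * aboveSum f u ≈ 0#) →
                 b * f u ≈ pathBelow g u * (C * Δsum h u ⁻¹) →
                 toggled f u ≈ b
  toggle-value g h f u {b} C≉0 Δh≉0 hu≈gu below above f·above≉0 balance =
    quotient-unique f·above≉0 (begin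
      belowSum f u                ≈⟨ belowSum-value g f u below ⟩
      B                           ≈⟨ sym rearranged ⟩
      (b * f u) * (U * C ⁻¹)      ≈⟨ *-congˡ (sym (aboveSum-value h f u C≉0 Δh≉0 above)) ⟩
      (b * f u) * aboveSum f u    ≈⟨ *-assoc _ _ _ ⟩
      b * (f u * aboveSum f u)    ∎)
    where
    B U : Carrier
    B = ∑ (filter (_⋖? ⟨ u ⟩) hatElems) (pathBeloŵ g)
    U = pathAbove h u
    ΔU : Δsum h u ≈ g u * U
    ΔU = trans (Δsum-factor h u) (*-congʳ hu≈gu)
    -- b·f(u)·U/C = A(u)·(C/Δsum h u)·U/C = g(u)B·U/(g(u)U) = B
    rearranged : (b * f u) * (U * C ⁻¹) ≈ B
    rearranged = begin
      (b * f u) * (U * C ⁻¹)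
        ≈⟨ *-congʳ (trans balance (*-congʳ (pathBelow-recursion g u))) ⟩
      ((g u * B) * (C * Δsum h u ⁻¹)) * (U * C ⁻¹)
        ≈⟨ solve 6 (λ gu b c di uu ci → ((gu :* b) :* (c :* di)) :* (uu :* ci) := b :* (((gu :* uu) :* di) :* (c :* ci)))
                 refl (g u) B C (Δsum h u ⁻¹) U (C ⁻¹) ⟩
      B * (((g u * U) * Δsum h u ⁻¹) * (C * C ⁻¹))
        ≈⟨ *-congˡ (*-cong (trans (*-congʳ (sym ΔU)) (⁻¹-inverseʳ _ (Δh≉0 u))) (⁻¹-inverseʳ C C≉0)) ⟩
      B * (1# * 1#)
        ≈⟨ trans (*-congˡ (*-identityˡ 1#)) (*-identityʳ B) ⟩
      B ∎

module LinearExtension (P : FinPoset) {Q : Fin (FinPoset.n P) → Set}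
                       (xs : List (Fin (FinPoset.n P))) (le : FinPoset.IsLinearExtension P Q xs) where
  open FinPoset P
  open IsLinearExtension le
  open HatOrder P using (<-irrefl)
  open import Data.List.Membership.Propositional using (_∈_)
  open import Data.List.Membership.Propositional.Properties using (∈-++⁺ʳ; ∈-++⁻)
  open import Data.List.Relation.Unary.AllPairs using (AllPairs; []; _∷_)
  open import Data.List.Relation.Unary.Unique.Propositional using (Unique)
  open import Data.Sum using (inj₁; inj₂)
  open import Function.Bundles using (Equivalence)
  import Data.List.Relation.Unary.All as All
  import Data.List.Relation.Unary.Any as Any
  import Data.List.Relation.Unary.Any.Properties as Any

  MayFollow : Fin n → Fin n → Set
  MayFollow a z = ¬ (z ≡ a) × ¬ (z < a)

  inOrder : ∀ (L : List (Fin n)) → Unique L → (∀ i j → lookup L i < lookup L j → i Fin.< j) →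
            AllPairs MayFollow L
  inOrder []      _          _        = []
  inOrder (a ∷ L) (a∉L ∷ uL) monotoneL =
    All.tabulate later ∷ inOrder L uL (λ i j → ℕ.≤-pred ∘ monotoneL (suc i) (suc j))
    where
    later : ∀ {z} → z ∈ L → MayFollow a z
    later z∈L = (λ { ≡.refl → All.lookup a∉L z∈L ≡.refl })
              , (λ z<a → ℕ.n≮0 (monotoneL (suc (Any.index z∈L)) zero (≡.subst (_< a) (Any.lookup-index z∈L) z<a)))

  orderedSplit : ∀ pre {a post} → pre ++ a ∷ post ≡ xs → AllPairs MayFollow (pre ++ a ∷ post)
  orderedSplit pre eq = ≡.subst (AllPairs MayFollow) (≡.sym eq) (inOrder xs distinct monotone)

  ∈xs : ∀ {y} → Q y → y ∈ xs
  ∈xs {y} = Equivalence.from (elements y)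

  xs∈ : ∀ {y} → y ∈ xs → Q y
  xs∈ {y} = Equivalence.to (elements y)

  split-member : ∀ pre {a post} → pre ++ a ∷ post ≡ xs → Q a
  split-member pre eq = xs∈ (≡.subst (_ ∈_) eq (∈-++⁺ʳ pre (here ≡.refl)))

  split-pre : ∀ pre {a post} → pre ++ a ∷ post ≡ xs → ∀ {y} → y ∈ pre → MayFollow y a
  split-pre pre eq = go pre (orderedSplit pre eq)
    where
    go : ∀ pre {a post} → AllPairs MayFollow (pre ++ a ∷ post) → ∀ {y} → y ∈ pre → MayFollow y a
    go (p ∷ pre) (p<· ∷ _)  (here ≡.refl) = All.lookup p<· (∈-++⁺ʳ pre (here ≡.refl))
    go (p ∷ pre) (_ ∷ rest) (there y∈)    = go pre rest y∈

  split-post : ∀ pre {a post} → pre ++ a ∷ post ≡ xs → ∀ {y} → y ∈ post → MayFollow a y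
  split-post pre eq = go pre (orderedSplit pre eq)
    where
    go : ∀ pre {a post} → AllPairs MayFollow (pre ++ a ∷ post) → ∀ {y} → y ∈ post → MayFollow a y
    go []        (a<· ∷ _)  = All.lookup a<·
    go (p ∷ pre) (_ ∷ rest) = go pre rest

  below-in-pre : ∀ pre {a post} → pre ++ a ∷ post ≡ xs → ∀ {y} → Q y → y < a → y ∈ pre
  below-in-pre pre eq Qy y<a with ∈-++⁻ pre (≡.subst (_ ∈_) (≡.sym eq) (∈xs Qy))
  ... | inj₁ y∈pre         = y∈pre
  ... | inj₂ (here ≡.refl) = ⊥-elim (<-irrefl y<a)
  ... | inj₂ (there y∈post) = ⊥-elim (proj₂ (split-post pre eq y∈post) y<a)

  above-in-post : ∀ pre {a post} → pre ++ a ∷ post ≡ xs → ∀ {y} → Q y → a < y → y ∈ post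
  above-in-post pre eq Qy a<y with ∈-++⁻ pre (≡.subst (_ ∈_) (≡.sym eq) (∈xs Qy))
  ... | inj₁ y∈pre          = ⊥-elim (proj₂ (split-pre pre eq y∈pre) a<y)
  ... | inj₂ (here ≡.refl)  = ⊥-elim (<-irrefl a<y)
  ... | inj₂ (there y∈post) = y∈post

module Conjugation {c ℓ} (K : Field c ℓ) (P : FinPoset) (C : Field.Carrier K)
                   (v : Fin (FinPoset.n P)) (g : Birational.Labeling K P C) where
  open Field K
  open FinPoset P
  open Birational K P C
  open FieldFacts K
  open ListSums commutativeSemiring
  open ChainSums K P
  open Toggle K P C
  open import Data.Fin.Properties using () renaming (_≟_ to _≟ᶠ_)
  open import Data.List.Membership.DecPropositional (_≟ᶠ_ {n}) using (_∈?_)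
  open import Relation.Binary.Reasoning.Setoid setoid
  open import Algebra.Solver.Ring.NaturalCoefficients.Default commutativeSemiring

  f₀ : Labeling
  f₀ y = C * Δsum g y ⁻¹

  S : Carrier
  S = ∑ (filter (v ∈?_) maximalChains) (chainWeight g)

  g′ : Labeling
  g′ = update g v (C * S ⁻¹)

  f₁ : Labeling
  f₁ y = C * Δsum g′ y ⁻¹

  g′-agrees : ∀ y → ¬ (y ≡ v) → g′ y ≈ g y
  g′-agrees y y≢v = reflexive (update-elsewhere g v _ y≢v)

  open Locality v g g′ g′-agrees

  module Nonvanishing (Δ≉0 : ∀ y → ¬ (Δsum g y ≈ 0#)) (S≉0 : ¬ (S ≈ 0#))
                      (Δ′≉0 : ∀ y → ¬ (Δsum g′ y ≈ 0#)) where

    -- C = 0 would make (τ_v g)(v) and hence Δsum g′ v vanish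
    C≉0 : ¬ (C ≈ 0#)
    C≉0 C≈0 = Δ′≉0 v (trans (Δsum-factor g′ v)
      (trans (*-congʳ (trans (reflexive (update-here g v _)) (trans (*-congʳ C≈0) (zeroˡ _)))) (zeroˡ _)))

    f₁-at-v : f₁ v ≈ pathBelow g v
    f₁-at-v = quotient-unique (Δ′≉0 v) (sym (begin
      pathBelow g v * Δsum g′ v
        ≈⟨ *-congˡ (trans (Δsum-factor g′ v) (*-cong (reflexive (update-here g v _)) pathAbove-local)) ⟩
      pathBelow g v * ((C * S ⁻¹) * pathAbove g v)
        ≈⟨ solve 4 (λ a c si u → a :* ((c :* si) :* u) := c :* ((a :* u) :* si))
                 refl (pathBelow g v) C (S ⁻¹) (pathAbove g v) ⟩
      C * ((pathBelow g v * pathAbove g v) * S ⁻¹)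
        ≈⟨ *-congˡ (*-congʳ (sym (maximalChains-through g v))) ⟩
      C * (S * S ⁻¹)
        ≈⟨ *-congˡ (⁻¹-inverseʳ S S≉0) ⟩
      C * 1#
        ≈⟨ *-identityʳ C ⟩
      C ∎))

    f₁-outside : ∀ y → ¬ (y ≡ v) → ¬ (y < v) → f₁ y ≈ f₀ y
    f₁-outside y y≢v y≮v = *-congˡ (⁻¹-cong (Δ≉0 y) (Δsum-local y y≢v y≮v))

    -- toggling bottom-up: f₀ becomes pathBelow g
    toggle-up : ∀ f u → ¬ (f u * aboveSum f u ≈ 0#) → f u ≈ f₀ u →
                (∀ y → y < u → f y ≈ pathBelow g y) → (∀ y → u < y → f y ≈ f₀ y) →
                toggled f u ≈ pathBelow g u
    toggle-up f u nz fu≈ below above = toggle-value g g f u C≉0 Δ≉0 refl below above nz (*-congˡ fu≈)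

    -- toggling top-down (away from v): pathBelow g becomes f₁
    toggle-down : ∀ f u → ¬ (u ≡ v) → ¬ (f u * aboveSum f u ≈ 0#) → f u ≈ pathBelow g u →
                  (∀ y → y < u → f y ≈ pathBelow g y) → (∀ y → u < y → f y ≈ f₁ y) →
                  toggled f u ≈ f₁ u
    toggle-down f u u≢v nz fu≈ below above =
      toggle-value g g′ f u C≉0 Δ′≉0 (g′-agrees u u≢v) below above nz (trans (*-congˡ fu≈) (*-comm _ _))

    module Sweeps (xs : List (Fin n)) (le : IsLinearExtension (_< v) xs) where
      open LinearExtension P xs le
      open HatOrder P using (<-trans; <-irrefl; module ≤)
      open import Data.List using (reverse; [_])
      open import Data.List.Membership.Propositional using (_∈_)
      import Data.List.Relation.Unary.Any.Properties as Any

      A : Labeling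
      A = pathBelow g

      reverse-cons-split : ∀ (a : Fin n) M post → reverse (a ∷ M) ++ post ≡ reverse M ++ a ∷ post
      reverse-cons-split a M post =
        ≡.trans (≡.cong (_++ post) (List.unfold-reverse a M)) (List.++-assoc (reverse M) [ a ] post)

      -- η_v⁻¹ toggles x₁, x₂, … in turn; after the first ones (the reverse
      -- of M) the labels there are A, elsewhere still f₀
      up-sweep : ∀ M post → reverse M ++ post ≡ xs → (d : Def (composeT M f₀)) →
                 val (composeT M f₀) d ≋ mix (_∈? M) A f₀
      up-sweep []      post eq d = λ _ → refl
      up-sweep (a ∷ M) post eq (d , e) = toggle-moves lab a M e IH new≈
        where
        eq′ : reverse M ++ a ∷ post ≡ xs
        eq′ = ≡.trans (≡.sym (reverse-cons-split a M post)) eq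
        lab : Labeling
        lab = val (composeT M f₀) d
        IH : lab ≋ mix (_∈? M) A f₀
        IH = up-sweep M (a ∷ post) eq′ d
        inM : ∀ {y} → y ∈ M → lab y ≈ A y
        inM y∈M = trans (IH _) (reflexive (mix-in (_∈? M) A f₀ y∈M))
        notInM : ∀ {y} → ¬ (y ∈ M) → lab y ≈ f₀ y
        notInM y∉M = trans (IH _) (reflexive (mix-out (_∈? M) A f₀ y∉M))
        new≈ : toggled lab a ≈ A a
        new≈ = toggle-up lab a (proj₁ (T-closed-form lab a e))
          (notInM (λ a∈M → proj₁ (split-pre (reverse M) eq′ (Any.reverse⁺ a∈M)) ≡.refl))
          (λ y y<a → inM (Any.reverse⁻ (below-in-pre (reverse M) eq′ (<-trans y<a (split-member (reverse M) eq′)) y<a)))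
          (λ y a<y → notInM (λ y∈M → proj₂ (split-pre (reverse M) eq′ (Any.reverse⁺ y∈M)) a<y))

      Middle : Labeling
      Middle = mix (_≤? v) A f₀

      middle : (dU : Def (η⁻¹ xs f₀)) (e : Def (T v (val (η⁻¹ xs f₀) dU))) →
               val (T v (val (η⁻¹ xs f₀) dU)) e ≋ Middle
      middle dU e y =
        trans (reflexive (proj₂ (T-closed-form lab v e) y))
              (update-mix (_∈? reverse xs) (_≤? v) up new≈ ≤.refl
                          (λ y y≢v y≤v → ∈rev (y≤v , y≢v)) (λ y → proj₁ ∘ rev∈) y)
        where
        lab : Labeling
        lab = val (η⁻¹ xs f₀) dU
        up : lab ≋ mix (_∈? reverse xs) A f₀
        up = up-sweep (reverse xs) [] (≡.trans (List.++-identityʳ _) (List.reverse-involutive xs)) dU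
        ∈rev : ∀ {y} → y < v → y ∈ reverse xs
        ∈rev = Any.reverse⁺ ∘ ∈xs
        rev∈ : ∀ {y} → y ∈ reverse xs → y < v
        rev∈ = xs∈ ∘ Any.reverse⁻
        below : ∀ {y} → y < v → lab y ≈ A y
        below y<v = trans (up _) (reflexive (mix-in (_∈? reverse xs) A f₀ (∈rev y<v)))
        notBelow : ∀ {y} → ¬ (y < v) → lab y ≈ f₀ y
        notBelow y≮v = trans (up _) (reflexive (mix-out (_∈? reverse xs) A f₀ (y≮v ∘ rev∈)))
        new≈ : toggled lab v ≈ A v
        new≈ = toggle-up lab v (proj₁ (T-closed-form lab v e)) (notBelow <-irrefl) (λ y → below)
                 (λ y v<y → notBelow (λ y<v → <-irrefl (<-trans v<y y<v)))

      settled : ∀ y → ¬ (y < v) → Middle y ≈ f₁ y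
      settled y y≮v = byCase (y ≟ᶠ v)
        where
        byCase : Dec (y ≡ v) → Middle y ≈ f₁ y
        byCase (yes ≡.refl) = trans (reflexive (mix-in (_≤? v) A f₀ ≤.refl)) (sym f₁-at-v)
        byCase (no y≢v)     = trans (reflexive (mix-out (_≤? v) A f₀ (λ y≤v → y≮v (y≤v , y≢v))))
                                    (sym (f₁-outside y y≢v y≮v))

      -- η_v toggles …, x₂, x₁ in turn; after the last ones (L) the labels
      -- there are f₁, elsewhere still Middle
      down-sweep : ∀ (h : Labeling) → h ≋ Middle → ∀ pre L → pre ++ L ≡ xs → (d : Def (composeT L h)) →
                   val (composeT L h) d ≋ mix (_∈? L) f₁ Middle
      down-sweep h h≋ pre []      eq d y = trans (h≋ y) (reflexive (≡.sym (mix-out (_∈? []) f₁ Middle λ ())))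
      down-sweep h h≋ pre (a ∷ L) eq (d , e) = toggle-moves lab a L e IH new≈
        where
        lab : Labeling
        lab = val (composeT L h) d
        IH : lab ≋ mix (_∈? L) f₁ Middle
        IH = down-sweep h h≋ (pre ++ [ a ]) L (≡.trans (List.++-assoc pre [ a ] L) eq) d
        a<v : a < v
        a<v = split-member pre eq
        notInL : ∀ {y} → ¬ (y ∈ L) → lab y ≈ Middle y
        notInL y∉L = trans (IH _) (reflexive (mix-out (_∈? L) f₁ Middle y∉L))
        labelA : ∀ {y} → y < v → ¬ (y ∈ L) → lab y ≈ A y
        labelA y<v y∉L = trans (notInL y∉L) (reflexive (mix-in (_≤? v) A f₀ (proj₁ y<v)))
        labelF₁ : ∀ y → a < y → lab y ≈ f₁ y
        labelF₁ y a<y with y ∈? L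
        ... | yes y∈L = trans (IH _) (reflexive (mix-in (_∈? L) f₁ Middle y∈L))
        ... | no  y∉L = trans (notInL y∉L) (settled y (λ y<v → y∉L (above-in-post pre eq y<v a<y)))
        new≈ : toggled lab a ≈ f₁ a
        new≈ = toggle-down lab a (λ { ≡.refl → <-irrefl a<v }) (proj₁ (T-closed-form lab a e))
                 (labelA a<v (λ a∈L → proj₁ (split-post pre eq a∈L) ≡.refl))
                 (λ y y<a → labelA (<-trans y<a a<v) (λ y∈L → proj₂ (split-post pre eq y∈L) y<a))
                 labelF₁

      conjugation : (dU : Def (η⁻¹ xs f₀)) (e : Def (T v (val (η⁻¹ xs f₀) dU)))
                    (d : Def (η xs (val (T v (val (η⁻¹ xs f₀) dU)) e))) →
                    val (η xs (val (T v (val (η⁻¹ xs f₀) dU)) e)) d ≋ f₁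
      conjugation dU e d y = trans (down-sweep _ (middle dU e) [] xs ≡.refl d y) (byCase (y ∈? xs))
        where
        byCase : Dec (y ∈ xs) → mix (_∈? xs) f₁ Middle y ≈ f₁ y
        byCase (yes y∈xs) = reflexive (mix-in (_∈? xs) f₁ Middle y∈xs)
        byCase (no y∉xs)  = trans (reflexive (mix-out (_∈? xs) f₁ Middle y∉xs)) (settled y (y∉xs ∘ ∈xs))

-- The definedness witnesses supply the nonvanishing of S (for τ_v), of Δsum g′
-- (for Θ on the left) and of Δsum g (for Θ on the right); the right-hand side
-- is η_v (T_v (η_v⁻¹ f₀)), evaluated by the sweeps.
theorem3p12 : ∀ {c ℓ} (K : Field c ℓ) → CharZero K →
    (P : FinPoset) (C : Field.Carrier K) (v : Fin (FinPoset.n P)) →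
    (xs : List (Fin (FinPoset.n P))) →
    FinPoset.IsLinearExtension P (λ x → FinPoset._<_ P x v) xs →
    let open Birational K P C in
    (g : Labeling) →
    (dL : Def ((Θ ∘ₚ (Δ⁻¹ ∘ₚ τ v)) g)) →
    (dR : Def ((τ* v xs ∘ₚ (Θ ∘ₚ Δ⁻¹)) g)) →
    val ((Θ ∘ₚ (Δ⁻¹ ∘ₚ τ v)) g) dL ≋ val ((τ* v xs ∘ₚ (Θ ∘ₚ Δ⁻¹)) g) dR
theorem3p12 K _ P C v xs le g (((S≉0 , _) , _) , Δ′≉0) ((_ , Δ≉0) , ((dU , e) , d)) y =
  sym (conjugation dU e d y)
  where
  open Field K using (sym)
  open Conjugation K P C v g
  open Nonvanishing Δ≉0 S≉0 Δ′≉0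
  open Sweeps xs le
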